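{- Let $G$ and $H$ be connected graphs such that $H\neq K_2$ and $\mathrm{Aut}(G[H])=\mathrm{Aut}(G)[\mathrm{Aut}(H)]$. Then $$D'(G[H])\leq \max\{D'(G),D'(H)\}.$$
   Context: All graphs are finite and simple. For a graph $X$, an edge labeling $\psi:E(X)\to\{1,\dots,d\}$ is distinguishing if the only automorphism of $X$ preserving all edge labels is the identity; the distinguishing index $D'(X)$ is the least $d$ such that $X$ has a distinguishing edge labeling with $d$ labels. The lexicographic product $G[H]$ has vertex set $V(G)\times V(H)$, with $(a,x)$ adjacent to $(b,y)$ iff $ab\in E(G)$, or $a=b$ and $xy\in E(H)$. The wreath product $\mathrm{Aut}(G)[\mathrm{Aut}(H)]$ is the subgroup of $\mathrm{Aut}(G[H])$ consisting of all maps $(g,h)\mapsto(\alpha g,\beta_g h)$ with $\alpha\in\mathrm{Aut}(G)$ and $\beta_g\in\mathrm{Aut}(H)$ for each $g\in V(G)$. -}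

module Defs where

open import Data.Nat using (ℕ; _⊔_)
open import Data.Bool using (Bool; true; false; _∨_; _∧_)
open import Data.Fin using (Fin; zero; suc)
open import Data.Fin.Properties using (*↔×; _≟_)
open import Data.Product using (Σ; ∃; _×_; _,_; proj₁; proj₂)
open import Relation.Binary.PropositionalEquality using (_≡_)
open import Relation.Nullary using (¬_; does)
open import Function.Bundles using (_↔_; Inverse; mk↔ₛ′)
open import Function.Properties.Inverse using (↔-trans)

record Graph : Set₁ where
  field
    V      : Set
    size   : ℕ
    finite : V ↔ Fin size
    adj    : V → V → Bool
    sym    : ∀ x y → adj x y ≡ adj y x
    irrefl : ∀ x → adj x x ≡ false

open Graph public

Adj : (X : Graph) → V X → V X → Set
Adj X x y = adj X x y ≡ true

data Reach (X : Graph) : V X → V X → Set where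
  here : ∀ {x} → Reach X x x
  step : ∀ {x y z} → Adj X x y → Reach X y z → Reach X x z

Connected : Graph → Set
Connected X = ∀ x y → Reach X x y

IsAut : (X : Graph) → (V X ↔ V X) → Set
IsAut X σ = ∀ x y → adj X (Inverse.to σ x) (Inverse.to σ y) ≡ adj X x y

Iso : Graph → Graph → Set
Iso X Y = Σ (V X ↔ V Y) λ f →
  ∀ x y → adj Y (Inverse.to f x) (Inverse.to f y) ≡ adj X x y

K2 : Graph
K2 = record
  { V = Fin 2 ; size = 2 ; finite = mk↔ₛ′ (λ x → x) (λ x → x) (λ _ → _≡_.refl) (λ _ → _≡_.refl)
  ; adj = λ x y → Data.Bool.not (does (x ≟ y))
  ; sym = symK ; irrefl = irrK }
  where
  symK : ∀ x y → Data.Bool.not (does (x ≟ y)) ≡ Data.Bool.not (does (y ≟ x))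
  symK zero zero = _≡_.refl
  symK zero (suc zero) = _≡_.refl
  symK (suc zero) zero = _≡_.refl
  symK (suc zero) (suc zero) = _≡_.refl
  irrK : ∀ x → Data.Bool.not (does (x ≟ x)) ≡ false
  irrK zero = _≡_.refl
  irrK (suc zero) = _≡_.refl

-- edge labelings with d labels: a label for each (unordered) edge,
-- represented by a function on ordered pairs which is symmetric on edges
-- (its values on non-edges are irrelevant).
record EdgeLabeling (X : Graph) (d : ℕ) : Set where
  field
    lab     : V X → V X → Fin d
    labSym  : ∀ x y → Adj X x y → lab x y ≡ lab y x

open EdgeLabeling public

PreservesLabels : (X : Graph) {d : ℕ} → EdgeLabeling X d → (V X ↔ V X) → Set
PreservesLabels X ψ σ =
  ∀ x y → Adj X x y → lab ψ (Inverse.to σ x) (Inverse.to σ y) ≡ lab ψ x y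

Distinguishing : (X : Graph) {d : ℕ} → EdgeLabeling X d → Set
Distinguishing X ψ = ∀ (σ : V X ↔ V X) → IsAut X σ → PreservesLabels X ψ σ →
  ∀ x → Inverse.to σ x ≡ x

HasDistLabeling : Graph → ℕ → Set
HasDistLabeling X d = Σ (EdgeLabeling X d) λ ψ → Distinguishing X ψ

IsDistIndex : Graph → ℕ → Set
IsDistIndex X d = HasDistLabeling X d × (∀ e → HasDistLabeling X e → d Data.Nat.≤ e)

Lex : Graph → Graph → Graph
Lex G H = record
  { V = V G × V H
  ; size = size G Data.Nat.* size H
  ; finite = ↔-trans (pairIso (finite G) (finite H)) (Function.Properties.Inverse.↔-sym *↔×)
  ; adj = λ { (a , x) (b , y) → adj G a b ∨ (does (eqG a b) ∧ adj H x y) }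
  ; sym = symL
  ; irrefl = irrL }
  where
  open import Relation.Binary.PropositionalEquality using (refl; cong; cong₂; trans)
  open import Relation.Nullary using (yes; no)
  open import Data.Product.Function.NonDependent.Propositional using (_×-↔_)
  pairIso : V G ↔ Fin (size G) → V H ↔ Fin (size H) → (V G × V H) ↔ (Fin (size G) × Fin (size H))
  pairIso f g = f ×-↔ g
  eqG : (a b : V G) → Relation.Nullary.Dec (a ≡ b)
  eqG a b with Inverse.to (finite G) a ≟ Inverse.to (finite G) b
  ... | yes p = yes (trans (sym' (Inverse.strictlyInverseʳ (finite G) a))
                     (trans (cong (Inverse.from (finite G)) p) (Inverse.strictlyInverseʳ (finite G) b)))
    where open import Relation.Binary.PropositionalEquality renaming (sym to sym')
  ... | no ¬p = no λ e → ¬p (cong (Inverse.to (finite G)) e)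
  symL : ∀ u w → _ ≡ _
  symL (a , x) (b , y) with eqG a b | eqG b a
  ... | yes refl | yes _ = cong₂ _∨_ (Graph.sym G a a) (cong (true ∧_) (Graph.sym H x y))
  ... | yes refl | no ¬q = Data.Empty.⊥-elim (¬q refl)
    where import Data.Empty
  ... | no ¬p | yes refl = Data.Empty.⊥-elim (¬p refl)
    where import Data.Empty
  ... | no _ | no _ = cong (_∨ false) (Graph.sym G a b)
  irrL : ∀ u → _ ≡ false
  irrL (a , x) with eqG a a
  ... | yes _ rewrite Graph.irrefl G a | Graph.irrefl H x = refl
  ... | no ¬p = Data.Empty.⊥-elim (¬p refl)
    where import Data.Empty

-- Aut(G[H]) = Aut(G)[Aut(H)]: an automorphism σ of G[H] lies in the wreath
-- product iff σ(g,h) = (α g, β_g h) with α ∈ Aut(G), β_g ∈ Aut(H).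
InWreath : (G H : Graph) → (V (Lex G H) ↔ V (Lex G H)) → Set
InWreath G H σ =
  Σ (V G ↔ V G) λ α → IsAut G α ×
  Σ (V G → V H ↔ V H) λ β → (∀ g → IsAut H (β g)) ×
  (∀ g h → Inverse.to σ (g , h) ≡ (Inverse.to α g , Inverse.to (β g) h))

AutIsWreath : Graph → Graph → Set
AutIsWreath G H = ∀ (σ : V (Lex G H) ↔ V (Lex G H)) →
  (IsAut (Lex G H) σ → InWreath G H σ) × (InWreath G H σ → IsAut (Lex G H) σ)

-- Give an edge between two fibres the ψ_G-label of its projection to G,
-- and an edge inside a fibre the ψ_H-label of its projection to H.  An
-- automorphism of G[H] is (g , h) ↦ (α g , β_g h) by hypothesis; preserving
-- this labeling forces α to preserve ψ_G and every β_g to preserve ψ_H,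
-- so all of them are identities.  Since having a distinguishing labeling
-- with d labels is decidable (a finite search), D'(G[H]) exists and is at
-- most the number of labels used, max (D'(G), D'(H)).
module Submission where

open import Defs
open import Data.Nat using (ℕ; _≤_; _⊔_)
open import Data.Product using (Σ; _×_)
open import Relation.Nullary using (¬_)

open import Data.Nat using (zero; suc; _*_; z≤n; s≤s)
open import Data.Nat.Properties using (anyUpTo?; ≮⇒≥; <-≤-trans; ≤-refl; m≤m⊔n; m≤n⊔m)
open import Data.Bool using (false; true; _∨_; if_then_else_)
import Data.Bool.Properties as Bool
open import Data.Fin using (Fin; inject≤)
open import Data.Fin.Properties using (any?; all?; inject≤-injective; *↔×) renaming (_≟_ to _≟ᶠ_)
open import Data.Vec.Functional using (_∷_; head; tail)
open import Data.Product using (∃; _,_; proj₁; proj₂; curry; uncurry)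
open import Data.Product.Function.NonDependent.Propositional using (_×-↔_)
open import Data.Empty using (⊥-elim)
open import Function using (_∘_)
open import Function.Bundles using (_↔_; Inverse; mk↔ₛ′)
open import Function.Properties.Inverse using (↔-refl; ↔-sym; ↔-trans; ↔⇒↣)
open import Relation.Binary.Definitions using (DecidableEquality)
open import Relation.Binary.PropositionalEquality as ≡ using (_≡_; _≗_; refl; trans; cong; cong₂; subst)
open import Relation.Nullary using (Dec; yes; no; ¬?)
open import Relation.Nullary.Decidable using (map′; _×-dec_; _→-dec_; decidable-stable; via-injection)

open Inverse

-- Without function extensionality, quantification over a finite function
-- space is only decidable for predicates respecting pointwise equality.
Extensional : {A B : Set} → ((A → B) → Set) → Set
Extensional P = ∀ {f f′} → f ≗ f′ → P f → P f′

anyVector? : ∀ k {m} {P : (Fin k → Fin m) → Set} →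
  Extensional P → (∀ f → Dec (P f)) → Dec (∃ P)
anyVector? zero    P-ext P? = map′ (_ ,_) (λ (f , p) → P-ext (λ ()) p) (P? λ ())
anyVector? (suc k) P-ext P? =
  map′ (λ (_ , _ , p) → _ , p)
       (λ (f , p) → head f , tail f , P-ext (λ { Fin.zero → refl ; (Fin.suc _) → refl }) p)
       (any? λ v → anyVector? k (λ f≗g → P-ext λ { Fin.zero → refl ; (Fin.suc i) → f≗g i })
                                (P? ∘ (v ∷_)))

module _ {A B : Set} {k m : ℕ} (A↔ : A ↔ Fin k) (B↔ : B ↔ Fin m) where

  anyFunction? : {P : (A → B) → Set} →
    Extensional P → (∀ f → Dec (P f)) → Dec (∃ P)
  anyFunction? {P} P-ext P? =
    map′ (λ (_ , p) → _ , p)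
         (λ (f , p) → to B↔ ∘ f ∘ from A↔ , P-ext (conjugate f) p)
         (anyVector? k (λ f≗g → P-ext (cong (from B↔) ∘ f≗g ∘ to A↔)) (P? ∘ transport))
    where
    transport : (Fin k → Fin m) → A → B
    transport g = from B↔ ∘ g ∘ to A↔
    conjugate : ∀ f → f ≗ transport (to B↔ ∘ f ∘ from A↔)
    conjugate f x = ≡.sym (trans (strictlyInverseʳ B↔ _) (cong f (strictlyInverseʳ A↔ x)))

  allFunctions? : {P : (A → B) → Set} →
    Extensional P → (∀ f → Dec (P f)) → Dec (∀ f → P f)
  allFunctions? P-ext P? =
    map′ (λ ∄¬P f → decidable-stable (P? f) (λ ¬p → ∄¬P (f , ¬p)))
         (λ ∀P (f , ¬p) → ¬p (∀P f))
         (¬? (anyFunction? (λ f≗g ¬p q → ¬p (P-ext (≡.sym ∘ f≗g) q)) (¬? ∘ P?)))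

allFinite? : {A : Set} {k : ℕ} → A ↔ Fin k → {P : A → Set} →
  (∀ x → Dec (P x)) → Dec (∀ x → P x)
allFinite? A↔ {P} P? =
  map′ (λ ∀P x → subst P (strictlyInverseʳ A↔ x) (∀P (to A↔ x)))
       (λ ∀P i → ∀P (from A↔ i))
       (all? (P? ∘ from A↔))

finite-≟ : {A : Set} {k : ℕ} → A ↔ Fin k → DecidableEquality A
finite-≟ A↔ = via-injection (↔⇒↣ A↔) _≟ᶠ_

allBijections? : {A : Set} {k : ℕ} → A ↔ Fin k → {Q : A ↔ A → Set} →
  (∀ {σ τ} → to σ ≗ to τ → Q σ → Q τ) → (∀ σ → Dec (Q σ)) → Dec (∀ σ → Q σ)
allBijections? {A} A↔ {Q} Q-resp Q? =
  map′ (λ ∀Q′ σ → Q-resp (λ _ → refl) (∀Q′ (to σ) (from σ) (strictlyInverseˡ σ , strictlyInverseʳ σ)))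
       (λ ∀Q f g inv → ∀Q (bijection inv))
       (allFunctions? A↔ A↔ QForInverses-ext λ f →
          allFunctions? A↔ A↔ (QIfInverse-ext f) (QIfInverse? f))
  where
  Inverses : (A → A) → (A → A) → Set
  Inverses f g = (f ∘ g ≗ λ y → y) × (g ∘ f ≗ λ x → x)

  bijection : ∀ {f g} → Inverses f g → A ↔ A
  bijection {f} {g} (fg , gf) = mk↔ₛ′ f g fg gf

  QIfInverse : (A → A) → (A → A) → Set
  QIfInverse f g = (inv : Inverses f g) → Q (bijection inv)

  QForInverses : (A → A) → Set
  QForInverses f = ∀ g → QIfInverse f g

  QIfInverse-ext : ∀ f → Extensional (QIfInverse f)
  QIfInverse-ext f g≗g′ q (fg′ , g′f) =
    Q-resp (λ _ → refl)
      (q ((λ y → trans (cong f (g≗g′ y)) (fg′ y)) , (λ x → trans (g≗g′ (f x)) (g′f x))))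

  QForInverses-ext : Extensional QForInverses
  QForInverses-ext f≗f′ q g (f′g , gf′) =
    Q-resp f≗f′
      (q g ((λ y → trans (f≗f′ (g y)) (f′g y)) , (λ x → trans (cong g (f≗f′ x)) (gf′ x))))

  QIfInverse? : ∀ f g → Dec (QIfInverse f g)
  QIfInverse? f g with allFinite? A↔ (λ y → finite-≟ A↔ (f (g y)) y)
                  ×-dec allFinite? A↔ (λ x → finite-≟ A↔ (g (f x)) x)
  ... | yes inv = map′ (λ q _ → Q-resp (λ _ → refl) q) (λ q → q inv) (Q? (bijection inv))
  ... | no ¬inv = yes (⊥-elim ∘ ¬inv)

module _ (X : Graph) where
  private
    _≟ᵥ_ : DecidableEquality (V X)
    _≟ᵥ_ = finite-≟ (finite X)

    allPairs? : {P : V X → V X → Set} → (∀ x y → Dec (P x y)) → Dec (∀ x y → P x y)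
    allPairs? P? = allFinite? (finite X) λ x → allFinite? (finite X) (P? x)

  isAut? : ∀ σ → Dec (IsAut X σ)
  isAut? σ = allPairs? λ x y → adj X (to σ x) (to σ y) Bool.≟ adj X x y

  preservesLabels? : ∀ {d} (ψ : EdgeLabeling X d) σ → Dec (PreservesLabels X ψ σ)
  preservesLabels? ψ σ =
    allPairs? λ x y → (adj X x y Bool.≟ true) →-dec (lab ψ (to σ x) (to σ y) ≟ᶠ lab ψ x y)

  distinguishing? : ∀ {d} (ψ : EdgeLabeling X d) → Dec (Distinguishing X ψ)
  distinguishing? ψ = allBijections? (finite X) (λ {σ} {τ} → fixes-resp {σ} {τ}) λ σ →
    isAut? σ →-dec preservesLabels? ψ σ →-dec allFinite? (finite X) (λ x → to σ x ≟ᵥ x)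
    where
    Fixes : (V X ↔ V X) → Set
    Fixes σ = IsAut X σ → PreservesLabels X ψ σ → ∀ x → to σ x ≡ x

    fixes-resp : ∀ {σ τ} → to σ ≗ to τ → Fixes σ → Fixes τ
    fixes-resp σ≗τ fixes τ-aut τ-pres x =
      trans (≡.sym (σ≗τ x)) (fixes (λ y z → trans (cong₂ (adj X) (σ≗τ y) (σ≗τ z)) (τ-aut y z))
                                   (λ y z e → trans (cong₂ (lab ψ) (σ≗τ y) (σ≗τ z)) (τ-pres y z e)) x)

  distinguishing-resp : ∀ {d} (ψ φ : EdgeLabeling X d) →
    (∀ x y → lab ψ x y ≡ lab φ x y) → Distinguishing X ψ → Distinguishing X φ
  distinguishing-resp ψ φ ψ≡φ dist σ σ-aut φ-pres =
    dist σ σ-aut λ x y e → trans (ψ≡φ _ _) (trans (φ-pres x y e) (≡.sym (ψ≡φ x y)))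

  hasDistLabeling? : ∀ d → Dec (HasDistLabeling X d)
  hasDistLabeling? d =
    map′ (λ (l , l-sym , dist) → tabulated l l-sym , dist)
         (λ (ψ , dist) → uncurry (lab ψ) , labSym ψ , dist)
         (anyFunction? pairs↔ ↔-refl DistTable-ext DistTable?)
    where
    pairs↔ : (V X × V X) ↔ Fin (size X * size X)
    pairs↔ = ↔-trans (finite X ×-↔ finite X) (↔-sym *↔×)

    SymmetricOnEdges : (V X × V X → Fin d) → Set
    SymmetricOnEdges l = ∀ x y → Adj X x y → l (x , y) ≡ l (y , x)

    tabulated : ∀ l → SymmetricOnEdges l → EdgeLabeling X d
    tabulated l l-sym = record { lab = curry l ; labSym = l-sym }

    DistTable : (V X × V X → Fin d) → Set
    DistTable l = Σ (SymmetricOnEdges l) λ l-sym → Distinguishing X (tabulated l l-sym)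

    DistTable-ext : Extensional DistTable
    DistTable-ext {l} {l′} l≗l′ (l-sym , dist) =
      l-sym′ , distinguishing-resp (tabulated l l-sym) (tabulated l′ l-sym′) (λ x y → l≗l′ (x , y)) dist
      where
      l-sym′ : SymmetricOnEdges l′
      l-sym′ x y e = trans (≡.sym (l≗l′ _)) (trans (l-sym x y e) (l≗l′ _))

    DistTable? : ∀ l → Dec (DistTable l)
    DistTable? l with allPairs? (λ x y → (adj X x y Bool.≟ true) →-dec (l (x , y) ≟ᶠ l (y , x)))
    ... | yes l-sym = map′ (l-sym ,_) proj₂ (distinguishing? (tabulated l l-sym))
    ... | no ¬l-sym = no (¬l-sym ∘ proj₁)

module _ {P : ℕ → Set} (P? : ∀ n → Dec (P n)) where

  least : ∀ {n} → P n → ∃ λ d → P d × (∀ e → P e → d ≤ e)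
  least {n} p = least-below n (n , ≤-refl , p)
    where
    least-below : ∀ n → (∃ λ m → m ≤ n × P m) → ∃ λ d → P d × (∀ e → P e → d ≤ e)
    least-below zero    (_ , z≤n , p) = 0 , p , λ _ _ → z≤n
    least-below (suc n) (m , m≤1+n , p) with anyUpTo? P? (suc n)
    ... | yes (k , s≤s k≤n , q) = least-below n (k , k≤n , q)
    ... | no ∄smaller = m , p , λ e q → ≮⇒≥ λ e<m → ∄smaller (e , <-≤-trans e<m m≤1+n , q)

distIndex-exists : ∀ X {e} → HasDistLabeling X e → ∃ λ d → IsDistIndex X d × d ≤ e
distIndex-exists X {e} has with least (hasDistLabeling? X) has
... | d , has-d , minimal = d , (has-d , minimal) , minimal e has

module _ (G H : Graph) where

  lex-adj-base : ∀ {a b} x y → Adj G a b → Adj (Lex G H) (a , x) (b , y)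
  lex-adj-base x y ab rewrite ab = refl

  lex-adj-fibre : ∀ g {x y} → Adj H x y → Adj (Lex G H) (g , x) (g , y)
  -- Lex decides a ≡ b by comparing codes in Fin; matching on that test
  -- makes it reduce.
  lex-adj-fibre g {x} {y} xy with to (finite G) g ≟ᶠ to (finite G) g
  ... | yes _ = trans (cong (_∨ adj H x y) (irrefl G g)) xy
  ... | no g≢g = ⊥-elim (g≢g refl)

  module _ {dG dH m : ℕ} (dG≤m : dG ≤ m) (dH≤m : dH ≤ m)
           (ψG : EdgeLabeling G dG) (ψH : EdgeLabeling H dH) where

    lexLab : V G × V H → V G × V H → Fin m
    lexLab (a , x) (b , y) =
      if adj G a b then inject≤ (lab ψG a b) dG≤m else inject≤ (lab ψH x y) dH≤m

    lexLab-base : ∀ {a b} x y → Adj G a b → lexLab (a , x) (b , y) ≡ inject≤ (lab ψG a b) dG≤m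
    lexLab-base x y ab rewrite ab = refl

    lexLab-fibre : ∀ {a b} x y → adj G a b ≡ false → lexLab (a , x) (b , y) ≡ inject≤ (lab ψH x y) dH≤m
    lexLab-fibre x y ab rewrite ab = refl

    lexLab-sym : ∀ u w → Adj (Lex G H) u w → lexLab u w ≡ lexLab w u
    lexLab-sym (a , x) (b , y) e with adj G a b in ab
    ... | true  = trans (cong (λ i → inject≤ i dG≤m) (labSym ψG a b ab))
                        (≡.sym (lexLab-base y x (trans (Graph.sym G b a) ab)))
    ... | false = trans (cong (λ i → inject≤ i dH≤m) (labSym ψH x y (Bool.∧-conicalʳ _ _ e)))
                        (≡.sym (lexLab-fibre y x (trans (Graph.sym G b a) ab)))

    lexLabeling : EdgeLabeling (Lex G H) m
    lexLabeling = record { lab = lexLab ; labSym = lexLab-sym }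

    lexLabeling-distinguishing : (∀ σ → IsAut (Lex G H) σ → InWreath G H σ) →
      Distinguishing G ψG → Distinguishing H ψH → Distinguishing (Lex G H) lexLabeling
    lexLabeling-distinguishing wreath distG distH σ σ-aut σ-pres (g , x)
      with wreath σ σ-aut
    ... | α , α-aut , β , β-aut , σ≡αβ =
      trans (σ≡αβ g x) (cong₂ _,_ (distG α α-aut α-pres g) (distH (β g) (β-aut g) (β-pres g) x))
      where
      open ≡.≡-Reasoning

      β-pres : ∀ g → PreservesLabels H ψH (β g)
      β-pres g y z yz = inject≤-injective dH≤m dH≤m _ _ (begin
        inject≤ (lab ψH (to (β g) y) (to (β g) z)) dH≤m
          ≡⟨ lexLab-fibre _ _ (irrefl G (to α g)) ⟨
        lexLab (to α g , to (β g) y) (to α g , to (β g) z)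
          ≡⟨ cong₂ lexLab (σ≡αβ g y) (σ≡αβ g z) ⟨
        lexLab (to σ (g , y)) (to σ (g , z))
          ≡⟨ σ-pres _ _ (lex-adj-fibre g yz) ⟩
        lexLab (g , y) (g , z)
          ≡⟨ lexLab-fibre y z (irrefl G g) ⟩
        inject≤ (lab ψH y z) dH≤m ∎)

      α-pres : PreservesLabels G ψG α
      α-pres a b ab = inject≤-injective dG≤m dG≤m _ _ (begin
        inject≤ (lab ψG (to α a) (to α b)) dG≤m
          ≡⟨ lexLab-base _ _ (trans (α-aut a b) ab) ⟨
        lexLab (to α a , to (β a) x) (to α b , to (β b) x)
          ≡⟨ cong₂ lexLab (σ≡αβ a x) (σ≡αβ b x) ⟨
        lexLab (to σ (a , x)) (to σ (b , x))
          ≡⟨ σ-pres _ _ (lex-adj-base x x ab) ⟩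
        lexLab (a , x) (b , x)
          ≡⟨ lexLab-base x x ab ⟩
        inject≤ (lab ψG a b) dG≤m ∎)

theorem3p1 : (G H : Graph) → Connected G → Connected H → ¬ Iso H K2 →
    AutIsWreath G H →
    (dG dH : ℕ) → IsDistIndex G dG → IsDistIndex H dH →
    Σ ℕ λ d → IsDistIndex (Lex G H) d × d ≤ dG ⊔ dH
theorem3p1 G H _ _ _ aut≡wreath dG dH ((ψG , distG) , _) ((ψH , distH) , _) =
  distIndex-exists (Lex G H)
    ( lexLabeling G H dG≤m dH≤m ψG ψH
    , lexLabeling-distinguishing G H dG≤m dH≤m ψG ψH (proj₁ ∘ aut≡wreath) distG distH)
  where
  dG≤m : dG ≤ dG ⊔ dH
  dG≤m = m≤m⊔n dG dH
  dH≤m : dH ≤ dG ⊔ dH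
  dH≤m = m≤n⊔m dG dH
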